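{- Let $a_0,d_0$ be coprime positive integers and let $\langle A(a_0,d_0), A(a_1,d_1), \ldots, A(a_n,d_n)\rangle$ be the sequence of arithmetic progressions $\mathfrak{S}(a_0,d_0)$. Let $\mathcal{G} = \langle A(a_\alpha,d_\alpha), A(a_{\alpha+1},d_{\alpha+1}), \ldots, A(a_\beta,d_\beta)\rangle$, with $0 \le \alpha < \beta \le n$, be a grouping of $\mathfrak{S}(a_0,d_0)$. Then for every $i$ with $\alpha \le i \le \beta$, $$\left\lfloor \frac{a_i}{d_i} \right\rfloor = \left\lfloor \frac{a_\alpha}{d_\alpha} \right\rfloor + (i-\alpha).$$
   Context: $A(x,y)$ denotes the arithmetic progression with leading term $x$ and common difference $y$. For coprime positive integers $a_0,d_0$, the sequence $\mathfrak{S}(a_0,d_0)$ is the finite sequence of distinct progressions $A(a_0,d_0), A(a_1,d_1), \ldots$ in which each consecutive pair satisfies $(a_k+jd_k)(a_{k+1}+jd_{k+1}) \equiv 1 \pmod{a_k+(j+1)d_k}$ for all $j\ge 0$, and $d_k \ge d_{k+1} \ge 1$. Explicitly: if $d_k = 1$ the sequence stops at $A(a_k,d_k)$; otherwise $d_{k+1}$ is the unique integer with $1 \le d_{k+1} < d_k$ and $a_k d_{k+1} \equiv 1 \pmod{d_k}$, and $a_{k+1} = d_{k+1} + \frac{a_k d_{k+1} - 1}{d_k}$ (so each $(a_k,d_k)$ is again a coprime pair). A grouping of $\mathfrak{S}(a_0,d_0)$ is a run $A(a_\alpha,d_\alpha),\ldots,A(a_\beta,d_\beta)$ of at least two consecutive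 progressions of the sequence such that $d_r - d_{r+1}$ is the same number $\triangle$ for all $\alpha \le r \le \beta-1$, and which is maximal with this property (cannot be extended by a neighbouring progression of the sequence while keeping the differences $d_r-d_{r+1}$ constant). The common value $\triangle$ is the second common difference of the grouping. -}

module Defs where

open import Data.Nat using (ℕ; zero; suc; _+_; _*_; _∸_; _≤_; _<_)
open import Data.Nat.DivMod using (_/_)
open import Data.Product using (_×_; Σ; proj₁; proj₂)
open import Relation.Binary.PropositionalEquality using (_≡_)
open import Relation.Nullary using (¬_)

-- floor division a / d, for d ≥ 1 (returns 0 when d = 0; never used there)
fdiv : ℕ → ℕ → ℕ
fdiv a zero    = 0
fdiv a (suc k) = a / suc k

-- One step of 𝔖: from A(a,d) with d ≠ 1 (d ≥ 2) to A(a',d'), where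
-- 1 ≤ d' < d, a·d' ≡ 1 (mod d), and a' = d' + (a·d' − 1)/d.
-- The last two conditions are expressed by a quotient q with q·d + 1 = a·d'.
record Step (a d a' d' : ℕ) : Set where
  field
    d≥2   : 1 < d
    d'≥1  : 1 ≤ d'
    d'<d  : d' < d
    q     : ℕ
    q-eq  : q * d + 1 ≡ a * d'
    a'-eq : a' ≡ d' + q

-- s k = (a_k , d_k).  IsSeq a₀ d₀ n s : s enumerates 𝔖(a₀,d₀) = ⟨A(a_0,d_0),…,A(a_n,d_n)⟩.
record IsSeq (a₀ d₀ n : ℕ) (s : ℕ → ℕ × ℕ) : Set where
  field
    start : s 0 ≡ (a₀ Data.Product., d₀)
    steps : ∀ k → k < n →
      Step (proj₁ (s k)) (proj₂ (s k)) (proj₁ (s (suc k))) (proj₂ (s (suc k)))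
    stop  : proj₂ (s n) ≡ 1

gap : (ℕ → ℕ × ℕ) → ℕ → ℕ
gap s r = proj₂ (s r) ∸ proj₂ (s (suc r))

record IsGrouping (n : ℕ) (s : ℕ → ℕ × ℕ) (α β Δ : ℕ) : Set where
  field
    α<β      : α < β
    β≤n      : β ≤ n
    constant : ∀ r → α ≤ r → r < β → gap s r ≡ Δ
    maxLeft  : ∀ α' → suc α' ≡ α → ¬ (gap s α' ≡ Δ)
    maxRight : β < n → ¬ (gap s β ≡ Δ)

{-# OPTIONS --safe #-}
-- Every step of 𝔖 raises ⌊a/d⌋ by exactly one: if q d + 1 = a d' with d ≥ 2, then
-- q = ⌊a d'/d⌋, so ⌊q/d'⌋ = ⌊a d'/(d d')⌋ = ⌊a/d⌋ and ⌊a'/d'⌋ = ⌊(d' + q)/d'⌋ = 1 + ⌊a/d⌋.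
-- Hence the identity holds along any run of consecutive steps; of the grouping
-- hypothesis only β ≤ n is needed.
module Submission where

open import Defs
open import Data.Nat using (ℕ; suc; _+_; _*_; _∸_; _≤_; _<_; _≤′_; ≤′-refl; ≤′-step; z<s; NonZero; >-nonZero)
open import Data.Nat.Properties
open import Data.Nat.DivMod
open import Data.Nat.Divisibility using (n∣m*n; ∣-refl)
open import Data.Nat.Coprimality using (Coprime)
open import Data.Product using (_×_; proj₁; proj₂)
open import Relation.Binary.PropositionalEquality
open ≡-Reasoning

fdiv≡/ : ∀ a d .{{_ : NonZero d}} → fdiv a d ≡ a / d
fdiv≡/ a (suc d) = refl

[m*n+1]/n≡m : ∀ m n .{{_ : NonZero n}} → 1 < n → (m * n + 1) / n ≡ m
[m*n+1]/n≡m m n 1<n = begin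
  (m * n + 1) / n  ≡⟨ +-distrib-/-∣ˡ 1 (n∣m*n m) ⟩
  m * n / n + 1 / n ≡⟨ cong₂ _+_ (m*n/n≡m m n) (m<n⇒m/n≡0 1<n) ⟩
  m + 0            ≡⟨ +-identityʳ m ⟩
  m                ∎

[n+m]/n≡1+m/n : ∀ m n .{{_ : NonZero n}} → (n + m) / n ≡ suc (m / n)
[n+m]/n≡1+m/n m n = begin
  (n + m) / n   ≡⟨ +-distrib-/-∣ˡ m ∣-refl ⟩
  n / n + m / n ≡⟨ cong (_+ m / n) (n/n≡1 n) ⟩
  suc (m / n)   ∎

q*d+1≡a*e⇒q/e≡a/d : ∀ a d e q .{{_ : NonZero d}} .{{_ : NonZero e}} →
                    1 < d → q * d + 1 ≡ a * e → q / e ≡ a / d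
q*d+1≡a*e⇒q/e≡a/d a d e q 1<d eq = begin
  q / e             ≡⟨ /-congˡ q≡ae/d ⟩
  a * e / d / e     ≡⟨ m/n/o≡m/[n*o] (a * e) d e ⟩
  a * e / (d * e)   ≡⟨ m*n/o*n≡m/o a e d ⟩
  a / d             ∎
  where
  q≡ae/d : q ≡ a * e / d
  q≡ae/d = trans (sym ([m*n+1]/n≡m q d 1<d)) (/-congˡ eq)
  instance
    de≢0 : NonZero (d * e)
    de≢0 = m*n≢0 d e

Step⇒fdiv≡suc : ∀ {a d a' d'} → Step a d a' d' → fdiv a' d' ≡ suc (fdiv a d)
Step⇒fdiv≡suc {a} {d} {a'} {d'} st = begin
  fdiv a' d'       ≡⟨ fdiv≡/ a' d' ⟩
  a' / d'          ≡⟨ /-congˡ a'-eq ⟩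
  (d' + q) / d'    ≡⟨ [n+m]/n≡1+m/n q d' ⟩
  suc (q / d')     ≡⟨ cong suc (q*d+1≡a*e⇒q/e≡a/d a d d' q d≥2 q-eq) ⟩
  suc (a / d)      ≡⟨ cong suc (fdiv≡/ a d) ⟨
  suc (fdiv a d)   ∎
  where
  open Step st
  instance
    d≢0 : NonZero d
    d≢0 = >-nonZero (<-trans z<s d≥2)
    d'≢0 : NonZero d'
    d'≢0 = >-nonZero d'≥1

increments-accumulate : (f : ℕ → ℕ) {α β : ℕ} →
                        (∀ k → α ≤ k → k < β → f (suc k) ≡ suc (f k)) →
                        ∀ i → α ≤ i → i ≤ β → f i ≡ f α + (i ∸ α)
increments-accumulate f {α} {β} inc i α≤i = go (≤⇒≤′ α≤i)
  where
  go : ∀ {i} → α ≤′ i → i ≤ β → f i ≡ f α + (i ∸ α)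
  go ≤′-refl _ = sym (trans (cong (f α +_) (n∸n≡0 α)) (+-identityʳ (f α)))
  go {suc j} (≤′-step α≤′j) j<β = begin
    f (suc j)              ≡⟨ inc j (≤′⇒≤ α≤′j) j<β ⟩
    suc (f j)              ≡⟨ cong suc (go α≤′j (<⇒≤ j<β)) ⟩
    suc (f α + (j ∸ α))    ≡⟨ +-suc (f α) (j ∸ α) ⟨
    f α + suc (j ∸ α)      ≡⟨ cong (f α +_) (+-∸-assoc 1 (≤′⇒≤ α≤′j)) ⟨
    f α + (suc j ∸ α)      ∎

lemma2 : (a₀ d₀ : ℕ) → 1 ≤ a₀ → 1 ≤ d₀ → Coprime a₀ d₀ →
    (n : ℕ) (s : ℕ → ℕ × ℕ) → IsSeq a₀ d₀ n s →
    (α β Δ : ℕ) → IsGrouping n s α β Δ →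
    ∀ i → α ≤ i → i ≤ β →
    fdiv (proj₁ (s i)) (proj₂ (s i)) ≡ fdiv (proj₁ (s α)) (proj₂ (s α)) + (i ∸ α)
lemma2 _ _ _ _ _ n s seq α β _ grouping =
  increments-accumulate (λ k → fdiv (proj₁ (s k)) (proj₂ (s k))) step-increments
  where
  step-increments : ∀ k → α ≤ k → k < β →
    fdiv (proj₁ (s (suc k))) (proj₂ (s (suc k))) ≡ suc (fdiv (proj₁ (s k)) (proj₂ (s k)))
  step-increments k _ k<β =
    Step⇒fdiv≡suc (IsSeq.steps seq k (<-≤-trans k<β (IsGrouping.β≤n grouping)))
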